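{- Let $k\ge 4$, let $(\mathcal{X},\mathcal{F})$ be a SET-COVER instance and $\mathbb{G}$ its reduction graph for $k$ as described in the context. If $E'$ is a good $k$-completion set of $\mathbb{G}$, then $\{S_j\in\mathcal{F}: (S_j,S'_j)\in E'\}$ is a subfamily of $\mathcal{F}$ of size $|E'|$ whose union is $\mathcal{X}$.
   Context: A SET-COVER instance consists of a finite set $\mathcal{X}=\{x_1,\dots,x_{|\mathcal X|}\}$ of items and a family $\mathcal{F}=\{S_1,\dots,S_{|\mathcal F|}\}$ of nonempty subsets of $\mathcal X$ whose union is $\mathcal X$. For $k\ge 4$ the reduction graph $\mathbb{G}$ is built as follows. (1) For each item $x_i$ add two vertices $x_i,x'_i$ and the edge $(x_i,x'_i)$ (item edge). (2) For each set $S_j$ add a graph $\mathbb{G}_j$ isomorphic to $K_{k-2}$ minus one edge; call the missing edge $(S_j,S'_j)$. (3) For each $x_i$ and $S_j$ with $x_i\in S_j$, join both $x_i$ and $x'_i$ to every vertex of $\mathbb{G}_j$. (4) For every edge $e$ present at this point other than the item edges, add $k-2$ new vertices forming together with the endpoints of $e$ a clique of order $k$. (5) Add a vertex $P$ and, for each $j$, the edge $(S_j,P)$ together with $k-2$ new vertices forming with $S_j$ and $P$ a clique of order $k$. A $k$-completion set of a graph $G=(V,E)$ is a set $E'$ of non-edges such that every edge of $(V,E\cup E')$ lies in a clique of order $k$. A good $k$-completion set of $\mathbb{G}$ is a $k$-completion set $E'\subseteq\{(S_1,S'_1),\dots,(S_{|\mathcal F|},S'_{|\mathcal F|})\}$.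 -}

module Defs where

open import Data.Nat using (ℕ; _∸_; _≤_)
open import Data.Fin using (Fin; _<_)
open import Data.Fin.Subset using (Subset; _∈_; Nonempty)
open import Data.Product using (Σ; _×_; _,_; ∃; ∃-syntax)
open import Data.Sum using (_⊎_)
open import Relation.Binary.PropositionalEquality using (_≡_; _≢_)
open import Relation.Nullary using (¬_)

-- Generic graph notions.  A graph on a vertex type V is given by an
-- adjacency relation Adj : V → V → Set (read as symmetric).

IsClique : {V : Set} → (V → V → Set) → (k : ℕ) → (Fin k → V) → Set
IsClique Adj k f =
  ((a b : Fin k) → f a ≡ f b → a ≡ b) ×
  ((a b : Fin k) → a ≢ b → Adj (f a) (f b))

InKClique : {V : Set} → (V → V → Set) → (k : ℕ) → V → V → Set
InKClique {V} Adj k u v =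
  Σ (Fin k → V) λ f → IsClique Adj k f × ∃[ a ] ∃[ b ] (f a ≡ u × f b ≡ v)

_∪E_ : {V : Set} → (V → V → Set) → (V → V → Set) → V → V → Set
(Adj ∪E E') u v = Adj u v ⊎ (E' u v ⊎ E' v u)

IsKCompletion : {V : Set} → ℕ → (V → V → Set) → (V → V → Set) → Set
IsKCompletion {V} k Adj E' =
  ((u v : V) → E' u v → (u ≢ v) × ¬ Adj u v × ¬ Adj v u) ×
  ((u v : V) → (Adj ∪E E') u v → InKClique (Adj ∪E E') k u v)

-- SET-COVER instances: items Fin n, sets S_j = F j for j : Fin m.

IsSetCoverInstance : (n m : ℕ) → (Fin m → Subset n) → Set
IsSetCoverInstance n m F =
  ((j : Fin m) → Nonempty (F j)) × ((i : Fin n) → ∃[ j ] (i ∈ F j))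

module Reduction (k n m : ℕ) (F : Fin m → Subset n) where

  -- Vertices of 𝔾_j (a copy of K_{k-2} minus the edge (S_j,S'_j)):
  -- S_j, S'_j and k-4 further vertices.
  data GV : Set where
    s s' : GV
    o    : Fin (k ∸ 4) → GV

  data InnerE : GV → GV → Set where
    s-o  : (a : Fin (k ∸ 4)) → InnerE s (o a)
    s'-o : (a : Fin (k ∸ 4)) → InnerE s' (o a)
    o-o  : {a b : Fin (k ∸ 4)} → a < b → InnerE (o a) (o b)

  data V3 : Set where
    x x' : Fin n → V3
    gv   : Fin m → GV → V3

  -- Edges after steps (1)-(3) OTHER than the item edges, each once.
  data Edge3 : V3 → V3 → Set where
    innerE : (j : Fin m) {g h : GV} → InnerE g h → Edge3 (gv j g) (gv j h)
    incE   : {i : Fin n} {j : Fin m} → i ∈ F j → (g : GV) → Edge3 (x i) (gv j g)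
    incE'  : {i : Fin n} {j : Fin m} → i ∈ F j → (g : GV) → Edge3 (x' i) (gv j g)

  NonItemEdge : Set
  NonItemEdge = Σ V3 λ u → Σ V3 λ v → Edge3 u v

  data V : Set where
    b   : V3 → V
    gad : NonItemEdge → Fin (k ∸ 2) → V
    P   : V
    pg  : Fin m → Fin (k ∸ 2) → V

  data Gen : V → V → Set where
    itemE : (i : Fin n) → Gen (b (x i)) (b (x' i))
    e3    : {u v : V3} → Edge3 u v → Gen (b u) (b v)
    gadL  : {u v : V3} (e : Edge3 u v) (t : Fin (k ∸ 2)) → Gen (gad (u , v , e) t) (b u)
    gadR  : {u v : V3} (e : Edge3 u v) (t : Fin (k ∸ 2)) → Gen (gad (u , v , e) t) (b v)
    gadG  : (d : NonItemEdge) {t t' : Fin (k ∸ 2)} → t < t' → Gen (gad d t) (gad d t')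
    SP    : (j : Fin m) → Gen (b (gv j s)) P
    pS    : (j : Fin m) (t : Fin (k ∸ 2)) → Gen (pg j t) (b (gv j s))
    pP    : (j : Fin m) (t : Fin (k ∸ 2)) → Gen (pg j t) P
    pG    : (j : Fin m) {t t' : Fin (k ∸ 2)} → t < t' → Gen (pg j t) (pg j t')

  Adj : V → V → Set
  Adj u v = Gen u v ⊎ Gen v u

  S S' : Fin m → V
  S  j = b (gv j s)
  S' j = b (gv j s')

  -- The subset E'_T = {(S_j,S'_j) : j ∈ T} of {(S_1,S'_1),…}.  Every
  -- subset of {(S_j,S'_j)} is E'_T for exactly one T : Subset m.
  E'of : Subset m → V → V → Set
  E'of T u v = ∃[ j ] (j ∈ T × u ≡ S j × v ≡ S' j)

{-# OPTIONS --safe #-}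
-- Every vertex of a k-clique through the item edge (x_i, x'_i), other than its ends, is a common
-- neighbour of x_i and x'_i, i.e. a vertex of some 𝔾_j with x_i ∈ S_j (the non-edges added in a
-- good completion never touch items).  Vertices of different 𝔾_j are never adjacent, so the other
-- k - 2 vertices of the clique form a clique inside a single 𝔾_j.  But 𝔾_j has exactly k - 2
-- vertices, so this clique contains both S_j and S'_j, which are adjacent only if (S_j, S'_j) ∈ E'.
module Submission where

open import Defs
open import Data.Nat using (ℕ; suc; _+_; _≤_; s≤s)
open import Data.Nat.Properties using (≤-refl)
open import Data.Fin using (Fin; zero; suc; punchIn; punchOut)
open import Data.Fin.Properties
  using (suc-injective; <⇒≢; pigeonhole; punchIn-injective; punchInᵢ≢i; punchIn-punchOut)
open import Data.Fin.Subset using (Subset; _∈_)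
open import Data.Product using (Σ; _×_; _,_; ∃-syntax)
open import Data.Sum using (inj₁; inj₂; swap)
open import Data.Empty using (⊥-elim)
open import Function using (_∘_)
open import Relation.Binary.Definitions using (Symmetric)
open import Relation.Binary.PropositionalEquality
  using (_≡_; _≢_; _≗_; refl; sym; trans; cong; subst₂)

module _ {V : Set} {Adj : V → V → Set} where

  ∪E-symmetric : {E' : V → V → Set} → Symmetric Adj → Symmetric (Adj ∪E E')
  ∪E-symmetric sym-Adj (inj₁ uv) = inj₁ (sym-Adj uv)
  ∪E-symmetric _       (inj₂ uv) = inj₂ (swap uv)

  IsClique-resp-≗ : ∀ {N} {f g : Fin N → V} → f ≗ g → IsClique Adj N f → IsClique Adj N g
  IsClique-resp-≗ f≗g (f-inj , f-adj) =
    (λ a b ga≡gb → f-inj a b (trans (f≗g a) (trans ga≡gb (sym (f≗g b))))) ,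
    (λ a b a≢b → subst₂ Adj (f≗g a) (f≗g b) (f-adj a b a≢b))

  IsClique-∘-injective : ∀ {M N} {f : Fin N → V} (ι : Fin M → Fin N) →
                         (∀ d e → ι d ≡ ι e → d ≡ e) → IsClique Adj N f → IsClique Adj M (f ∘ ι)
  IsClique-∘-injective ι ι-inj (f-inj , f-adj) =
    (λ d e fιd≡fιe → ι-inj d e (f-inj (ι d) (ι e) fιd≡fιe)) ,
    (λ d e d≢e → f-adj (ι d) (ι e) (d≢e ∘ ι-inj d e))

  common-neighbourhood-clique : ∀ {N} {u v : V} → u ≢ v → InKClique Adj (2 + N) u v →
    Σ (Fin N → V) λ g → IsClique Adj N g × (∀ d → Adj u (g d) × Adj v (g d))
  common-neighbourhood-clique {N} u≢v (f , f-clique@(_ , f-adj) , a , a' , refl , refl) =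
    f ∘ ι , IsClique-∘-injective ι ι-injective f-clique ,
    λ d → f-adj a (ι d) (ι≢a d ∘ sym) , f-adj a' (ι d) (ι≢a' d ∘ sym)
    where
      a≢a' : a ≢ a'
      a≢a' = u≢v ∘ cong f

      ι : Fin N → Fin (2 + N)
      ι d = punchIn a (punchIn (punchOut a≢a') d)

      ι-injective : ∀ d e → ι d ≡ ι e → d ≡ e
      ι-injective d e = punchIn-injective _ d e ∘ punchIn-injective a _ _

      ι≢a : ∀ d → ι d ≢ a
      ι≢a d = punchInᵢ≢i a _

      ι≢a' : ∀ d → ι d ≢ a'
      ι≢a' d ιd≡a' = punchInᵢ≢i (punchOut a≢a') d
        (punchIn-injective a _ _ (trans ιd≡a' (sym (punchIn-punchOut a≢a'))))

module _ (k' n m : ℕ) (F : Fin m → Subset n) (T : Subset m) where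

  open Reduction (4 + k') n m F

  Adj∪E' : V → V → Set
  Adj∪E' = Adj ∪E E'of T

  Adj∪E'-symmetric : Symmetric Adj∪E'
  Adj∪E'-symmetric = ∪E-symmetric {Adj = Adj} {E' = E'of T} swap

  record SetGadgetVertex (i : Fin n) (w : V) : Set where
    constructor setGadgetVertex
    field
      block  : Fin m
      member : i ∈ F block
      slot   : GV
      w≡     : w ≡ b (gv block slot)

  open SetGadgetVertex

  item-common-neighbour : ∀ {i w} → Adj∪E' (b (x i)) w → Adj∪E' (b (x' i)) w → SetGadgetVertex i w
  item-common-neighbour (inj₁ (inj₁ (e3 (incE i∈Fj g)))) _ = setGadgetVertex _ i∈Fj g refl
  item-common-neighbour (inj₁ (inj₁ (itemE _))) (inj₁ (inj₁ (e3 ())))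
  item-common-neighbour (inj₁ (inj₁ (itemE _))) (inj₁ (inj₂ (e3 ())))
  item-common-neighbour (inj₁ (inj₁ (itemE _))) (inj₂ (inj₁ (_ , _ , () , _)))
  item-common-neighbour (inj₁ (inj₁ (itemE _))) (inj₂ (inj₂ (_ , _ , () , _)))
  item-common-neighbour (inj₁ (inj₂ (gadL (incE _ _) _))) (inj₁ (inj₁ ()))
  item-common-neighbour (inj₁ (inj₂ (gadL (incE _ _) _))) (inj₁ (inj₂ ()))
  item-common-neighbour (inj₁ (inj₂ (gadL (incE _ _) _))) (inj₂ (inj₁ (_ , _ , () , _)))
  item-common-neighbour (inj₁ (inj₂ (gadL (incE _ _) _))) (inj₂ (inj₂ (_ , _ , _ , ())))
  item-common-neighbour (inj₂ (inj₁ (_ , _ , () , _))) _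
  item-common-neighbour (inj₂ (inj₂ (_ , _ , _ , ()))) _

  adjacent-gadgets-equal : ∀ {j j' g g'} → Adj∪E' (b (gv j g)) (b (gv j' g')) → j ≡ j'
  adjacent-gadgets-equal (inj₁ (inj₁ (e3 (innerE _ _)))) = refl
  adjacent-gadgets-equal (inj₁ (inj₂ (e3 (innerE _ _)))) = refl
  adjacent-gadgets-equal (inj₂ (inj₁ (_ , _ , refl , refl))) = refl
  adjacent-gadgets-equal (inj₂ (inj₂ (_ , _ , refl , refl))) = refl

  S-S'-adjacent⇒∈T : ∀ {j} → Adj∪E' (S j) (S' j) → j ∈ T
  S-S'-adjacent⇒∈T (inj₁ (inj₁ (e3 (innerE _ ()))))
  S-S'-adjacent⇒∈T (inj₁ (inj₂ (e3 (innerE _ ()))))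
  S-S'-adjacent⇒∈T (inj₂ (inj₁ (_ , j∈T , refl , refl))) = j∈T
  S-S'-adjacent⇒∈T (inj₂ (inj₂ (_ , _ , () , _)))

  -- Identifies S_j with S'_j, so that the k - 2 vertices of 𝔾_j take only k - 3 values.
  slotCode : GV → Fin (1 + k')
  slotCode s     = zero
  slotCode s'    = zero
  slotCode (o a) = suc a

  slotCode-collision⇒∈T : ∀ {j g h} → slotCode g ≡ slotCode h → g ≢ h →
                          Adj∪E' (b (gv j g)) (b (gv j h)) → j ∈ T
  slotCode-collision⇒∈T {g = s}   {s}   _ g≢h _ = ⊥-elim (g≢h refl)
  slotCode-collision⇒∈T {g = s}   {s'}  _ _ gh  = S-S'-adjacent⇒∈T gh
  slotCode-collision⇒∈T {g = s'}  {s}   _ _ gh  = S-S'-adjacent⇒∈T (Adj∪E'-symmetric gh)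
  slotCode-collision⇒∈T {g = s'}  {s'}  _ g≢h _ = ⊥-elim (g≢h refl)
  slotCode-collision⇒∈T {g = o _} {o _} same g≢h _ = ⊥-elim (g≢h (cong o (suc-injective same)))
  slotCode-collision⇒∈T {g = s}   {o _} ()
  slotCode-collision⇒∈T {g = s'}  {o _} ()
  slotCode-collision⇒∈T {g = o _} {s}   ()
  slotCode-collision⇒∈T {g = o _} {s'}  ()

  full-gadget-clique⇒∈T : ∀ {j} (h : Fin (2 + k') → GV) →
                          IsClique Adj∪E' (2 + k') (b ∘ gv j ∘ h) → j ∈ T
  full-gadget-clique⇒∈T {j} h (inj , adj) with pigeonhole ≤-refl (slotCode ∘ h)
  ... | d , e , d<e , same =
    slotCode-collision⇒∈T same (<⇒≢ d<e ∘ inj d e ∘ cong (b ∘ gv j)) (adj d e (<⇒≢ d<e))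

  common-neighbour-clique-in-one-gadget : ∀ {i N} (g : Fin (1 + N) → V) →
    IsClique Adj∪E' (1 + N) g →
    (∀ d → Adj∪E' (b (x i)) (g d) × Adj∪E' (b (x' i)) (g d)) →
    ∃[ j ] (i ∈ F j × Σ (Fin (1 + N) → GV) λ h → g ≗ b ∘ gv j ∘ h)
  common-neighbour-clique-in-one-gadget g (_ , adj) common =
    block (vertex zero) , member (vertex zero) , slot ∘ vertex ,
    λ d → trans (w≡ (vertex d)) (cong (λ j → b (gv j (slot (vertex d)))) (same-block d))
    where
      vertex : ∀ d → SetGadgetVertex _ (g d)
      vertex d = let (xd , x'd) = common d in item-common-neighbour xd x'd

      same-block : ∀ d → block (vertex d) ≡ block (vertex zero)
      same-block zero    = refl
      same-block (suc d) = sym (adjacent-gadgets-equal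
        (subst₂ Adj∪E' (w≡ (vertex zero)) (w≡ (vertex (suc d))) (adj zero (suc d) λ ())))

lemma4 : (k n m : ℕ) → 4 ≤ k → (F : Fin m → Subset n) → IsSetCoverInstance n m F →
           (T : Subset m) → IsKCompletion k (Reduction.Adj k n m F) (Reduction.E'of k n m F T) →
           (i : Fin n) → ∃[ j ] (j ∈ T × i ∈ F j)
lemma4 (suc (suc (suc (suc k')))) n m (s≤s (s≤s (s≤s (s≤s _)))) F _ T (_ , completes) i
  with common-neighbourhood-clique {Adj = Adj∪E' k' n m F T} (λ ())
         (completes _ _ (inj₁ (inj₁ (Reduction.itemE i))))
... | g , g-clique , common
  with common-neighbour-clique-in-one-gadget k' n m F T g g-clique common
... | j , i∈Fj , h , g≗h =
  j , full-gadget-clique⇒∈T k' n m F T h (IsClique-resp-≗ {Adj = Adj∪E' k' n m F T} g≗h g-clique) ,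
  i∈Fj
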